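{- Let $G$ and $H$ be finite simple connected non-bipartite graphs, each having at least two universal vertices. Then $\gamma_{P,c}(G\times H)=2$.
   Context: A universal vertex is a vertex adjacent to every other vertex. Power domination: for $S\subseteq V(X)$, start with $M(S)=N[S]$ and repeatedly add a vertex $w$ whenever some $v\in M(S)$ has $w$ as its unique neighbour outside $M(S)$; $S$ is a connected power dominating set if the final $M(S)$ is $V(X)$ and $\langle S\rangle$ is connected; $\gamma_{P,c}(X)$ is the minimum size of such a set. The tensor product $G\times H$ has vertex set $V(G)\times V(H)$, with $(a,b)\sim(x,y)$ iff $ax\in E(G)$ and $by\in E(H)$. -}

module Defs where

open import Data.Nat using (ℕ; _*_)
open import Data.Bool using (Bool; true; false; _∧_)
open import Data.Bool.Properties using (∧-comm)
open import Data.Fin using (Fin; quotient; remainder)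
open import Data.Fin.Subset using (Subset; _∈_; ∣_∣)
open import Data.Product using (Σ; ∃; ∃-syntax; _×_; _,_)
open import Data.Empty using (⊥)
open import Data.Unit using (⊤)
open import Relation.Nullary using (¬_)
open import Relation.Binary.PropositionalEquality using (_≡_; _≢_; refl; cong₂)

record Graph : Set where
  field
    n     : ℕ
    adj   : Fin n → Fin n → Bool
    sym   : ∀ u v → adj u v ≡ adj v u
    irrefl : ∀ v → adj v v ≡ false

open Graph public

Adj : (G : Graph) → Fin (n G) → Fin (n G) → Set
Adj G u v = adj G u v ≡ true

-- walks staying inside a vertex predicate P (all vertices, including the
-- start, are required to satisfy P by the users below)
data Reach (G : Graph) (P : Fin (n G) → Set) (u : Fin (n G)) : Fin (n G) → Set where
  here : Reach G P u u
  step : ∀ {v w} → Reach G P u v → Adj G v w → P w → Reach G P u w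

Connected : Graph → Set
Connected G = ∀ u v → Reach G (λ _ → ⊤) u v

Bipartite : Graph → Set
Bipartite G = Σ (Fin (n G) → Bool) λ c → ∀ u v → Adj G u v → c u ≢ c v

Universal : (G : Graph) → Fin (n G) → Set
Universal G v = ∀ w → w ≢ v → Adj G v w

AtLeastTwoUniversal : Graph → Set
AtLeastTwoUniversal G = ∃[ u ] ∃[ v ] (u ≢ v × Universal G u × Universal G v)

-- tensor product G × H on vertex set Fin (n G * n H);
-- the pair (a , b) is encoded as combine a b, decoded by quotient/remainder
tensor : Graph → Graph → Graph
tensor G H = record
  { n = n G * n H
  ; adj = λ x y → adj G (fstV x) (fstV y) ∧ adj H (sndV x) (sndV y)
  ; sym = λ x y → cong₂ _∧_ (sym G _ _) (sym H _ _)
  ; irrefl = λ x → irr (fstV x) (sndV x)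
  }
  where
  fstV : Fin (n G * n H) → Fin (n G)
  fstV = quotient {n G} (n H)
  sndV : Fin (n G * n H) → Fin (n H)
  sndV = remainder {n G} (n H)
  irr : ∀ a b → adj G a a ∧ adj H b b ≡ false
  irr a b with adj G a a | irrefl G a
  ... | .false | refl = refl

-- Monitored set M(S): least set containing N[S] and closed under the
-- propagation rule (v ∈ M, w the unique neighbour of v outside M ⇒ w ∈ M).
data Monitored (G : Graph) (S : Subset (n G)) : Fin (n G) → Set where
  inS  : ∀ {v} → v ∈ S → Monitored G S v
  nbr  : ∀ {u v} → u ∈ S → Adj G u v → Monitored G S v
  prop : ∀ {v w} → Monitored G S v → Adj G v w
       → (∀ w′ → Adj G v w′ → w′ ≢ w → Monitored G S w′)
       → Monitored G S w

InducedConnected : (G : Graph) → Subset (n G) → Set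
InducedConnected G S = ∀ u v → u ∈ S → v ∈ S → Reach G (_∈ S) u v

IsCPDS : (G : Graph) → Subset (n G) → Set
IsCPDS G S = (∀ v → Monitored G S v) × InducedConnected G S

ConnPowerDomNumber : Graph → ℕ → Set
ConnPowerDomNumber G k =
  (Σ (Subset (n G)) λ S → IsCPDS G S × ∣ S ∣ ≡ k)
  × (∀ S → IsCPDS G S → k Data.Nat.≤ ∣ S ∣)

-- For universal vertices u₁ ≠ u₂ of G and v₁ ≠ v₂ of H, the adjacent pair S = {(u₁,v₁), (u₂,v₂)}
-- dominates every vertex of G × H except (u₁,v₂) and (u₂,v₁). These are then forced from (w,v₁)
-- and (w,v₂), where w is a third vertex of G, which exists because G is not bipartite.
-- Conversely, both factors have minimum degree at least two, and then a single vertex (a,b) never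
-- monitors the vertices sharing exactly one coordinate with it: every neighbour of such a vertex
-- is adjacent to a second one, so propagation can never reach them.
module Submission where

open import Defs hiding (sym)
open import Data.Nat using (suc; _*_; _≤_; _≤?_; s≤s)
open import Data.Nat.Properties using (≰⇒>; ≤-trans; ≤-reflexive)
open import Data.Bool using (Bool; true)
import Data.Bool.Properties as Bool
open import Data.Fin using (Fin; combine; quotient; remainder; _≟_)
import Data.Fin as Fin
open import Data.Fin.Properties using (remQuot-combine; combine-remQuot; ¬∀⟶∃¬)
open import Data.Fin.Subset using (Subset; _∈_; _⊆_; ∣_∣; ⁅_⁆; _∪_; Nonempty)
open import Data.Fin.Subset.Properties
  using (x∈⁅x⁆; x∈⁅y⁆⇒x≡y; x∈p∪q⁻; x∈p∪q⁺; ∣⁅x⁆∣≡1; ∪-identityˡ; ∪-identityʳ; p⊆q⇒∣p∣≤∣q∣)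
open import Data.Product using (_×_; _,_; proj₁; proj₂; ∃; ∃-syntax; ∃₂)
open import Data.Sum using (_⊎_; inj₁; inj₂; [_,_])
open import Data.Empty using (⊥-elim)
open import Relation.Nullary using (¬_; Dec; yes; no; _⊎-dec_)
open import Relation.Nullary.Decidable using (⌊_⌋)
open import Relation.Binary.PropositionalEquality using (_≡_; _≢_; refl; sym; ≢-sym; trans; cong; subst)

∣⁅x⁆∪⁅y⁆∣≡2 : ∀ {k} {x y : Fin k} → x ≢ y → ∣ ⁅ x ⁆ ∪ ⁅ y ⁆ ∣ ≡ 2
∣⁅x⁆∪⁅y⁆∣≡2 {x = Fin.zero}  {Fin.zero}  x≢y = ⊥-elim (x≢y refl)
∣⁅x⁆∪⁅y⁆∣≡2 {x = Fin.zero}  {Fin.suc y} _   = cong suc (trans (cong ∣_∣ (∪-identityˡ ⁅ y ⁆)) (∣⁅x⁆∣≡1 y))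
∣⁅x⁆∪⁅y⁆∣≡2 {x = Fin.suc x} {Fin.zero}  _   = cong suc (trans (cong ∣_∣ (∪-identityʳ ⁅ x ⁆)) (∣⁅x⁆∣≡1 x))
∣⁅x⁆∪⁅y⁆∣≡2 {x = Fin.suc x} {Fin.suc y} x≢y = ∣⁅x⁆∪⁅y⁆∣≡2 (λ x≡y → x≢y (cong Fin.suc x≡y))

x∈⁅y⁆∪⁅z⁆⁻ : ∀ {k} {x y z : Fin k} → x ∈ ⁅ y ⁆ ∪ ⁅ z ⁆ → x ≡ y ⊎ x ≡ z
x∈⁅y⁆∪⁅z⁆⁻ {y = y} {z} x∈ with x∈p∪q⁻ ⁅ y ⁆ ⁅ z ⁆ x∈
... | inj₁ x∈⁅y⁆ = inj₁ (x∈⁅y⁆⇒x≡y y x∈⁅y⁆)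
... | inj₂ x∈⁅z⁆ = inj₂ (x∈⁅y⁆⇒x≡y z x∈⁅z⁆)

⁅x⁆∪⁅y⁆⊆p : ∀ {k} {p : Subset k} {x y} → x ∈ p → y ∈ p → ⁅ x ⁆ ∪ ⁅ y ⁆ ⊆ p
⁅x⁆∪⁅y⁆⊆p x∈p y∈p z∈ = [ (λ { refl → x∈p }) , (λ { refl → y∈p }) ] (x∈⁅y⁆∪⁅z⁆⁻ z∈)

∣p∣≤1⇒x∈p⇒y∈p⇒x≡y : ∀ {k} {p : Subset k} {x y} → ∣ p ∣ ≤ 1 → x ∈ p → y ∈ p → x ≡ y
∣p∣≤1⇒x∈p⇒y∈p⇒x≡y {x = x} {y} ∣p∣≤1 x∈p y∈p with x ≟ y
... | yes x≡y = x≡y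
... | no x≢y with ≤-trans (≤-reflexive (sym (∣⁅x⁆∪⁅y⁆∣≡2 x≢y)))
                          (≤-trans (p⊆q⇒∣p∣≤∣q∣ (⁅x⁆∪⁅y⁆⊆p x∈p y∈p)) ∣p∣≤1)
... | s≤s ()

module _ (G : Graph) where

  Adj? : ∀ u v → Dec (Adj G u v)
  Adj? u v = adj G u v Bool.≟ true

  Adj-sym : ∀ {u v} → Adj G u v → Adj G v u
  Adj-sym {u} {v} = trans (Graph.sym G v u)

  Adj⇒≢ : ∀ {u v} → Adj G u v → u ≢ v
  Adj⇒≢ {u} u~u refl with trans (sym u~u) (irrefl G u)
  ... | ()

  coveredByTwo⇒Bipartite : ∀ {u₁ u₂} → (∀ x → x ≡ u₁ ⊎ x ≡ u₂) → Bipartite G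
  coveredByTwo⇒Bipartite {u₁} {u₂} cover = colour , proper
    where
    colour : Fin (n G) → Bool
    colour x = ⌊ x ≟ u₁ ⌋
    proper : ∀ x y → Adj G x y → colour x ≢ colour y
    proper x y x~y same with x ≟ u₁ | y ≟ u₁
    ... | yes x≡u₁ | yes y≡u₁ = Adj⇒≢ x~y (trans x≡u₁ (sym y≡u₁))
    ... | no x≢u₁  | no y≢u₁  = Adj⇒≢ x~y (trans (other x x≢u₁) (sym (other y y≢u₁)))
      where
      other : ∀ z → z ≢ u₁ → z ≡ u₂
      other z z≢u₁ = [ (λ z≡u₁ → ⊥-elim (z≢u₁ z≡u₁)) , (λ z≡u₂ → z≡u₂) ] (cover z)
    proper x y x~y () | yes _ | no _
    proper x y x~y () | no _  | yes _

  ¬Bipartite⇒third-vertex : ¬ Bipartite G → ∀ u₁ u₂ → ∃[ w ] (w ≢ u₁ × w ≢ u₂)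
  ¬Bipartite⇒third-vertex ¬bip u₁ u₂ with ¬∀⟶∃¬ (n G) _ (λ x → (x ≟ u₁) ⊎-dec (x ≟ u₂))
                                              (λ cover → ¬bip (coveredByTwo⇒Bipartite cover))
  ... | w , w∉ = w , (λ w≡u₁ → w∉ (inj₁ w≡u₁)) , (λ w≡u₂ → w∉ (inj₂ w≡u₂))

MinDegree≥2 : Graph → Set
MinDegree≥2 G = ∀ x → ∃₂ λ y z → Adj G x y × Adj G x z × y ≢ z

neighbour-avoiding : ∀ {G} → MinDegree≥2 G → ∀ x c → ∃[ y ] (Adj G x y × y ≢ c)
neighbour-avoiding δ x c with δ x
... | y , z , x~y , x~z , y≢z with y ≟ c
...   | yes refl = z , x~z , ≢-sym y≢z
...   | no y≢c   = y , x~y , y≢c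

twoUniversal⇒MinDegree≥2 : ∀ {G u₁ u₂ w} → Universal G u₁ → Universal G u₂ → u₁ ≢ u₂
                         → w ≢ u₁ → w ≢ u₂ → MinDegree≥2 G
twoUniversal⇒MinDegree≥2 {G} {u₁} {u₂} {w} U₁ U₂ u₁≢u₂ w≢u₁ w≢u₂ x with x ≟ u₁ | x ≟ u₂
... | yes refl | _        = u₂ , w , U₁ u₂ (≢-sym u₁≢u₂) , U₁ w w≢u₁ , ≢-sym w≢u₂
... | no _     | yes refl = u₁ , w , U₂ u₁ u₁≢u₂ , U₂ w w≢u₂ , ≢-sym w≢u₁
... | no x≢u₁  | no x≢u₂  = u₁ , u₂ , Adj-sym G (U₁ x x≢u₁) , Adj-sym G (U₂ x x≢u₂) , u₁≢u₂

PowerDominating : (G : Graph) → Subset (n G) → Set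
PowerDominating G S = ∀ v → Monitored G S v

Monitored⇒Nonempty : ∀ {G S v} → Monitored G S v → Nonempty S
Monitored⇒Nonempty (inS v∈S)     = _ , v∈S
Monitored⇒Nonempty (nbr u∈S _)   = _ , u∈S
Monitored⇒Nonempty (prop v∈M _ _) = Monitored⇒Nonempty v∈M

module Tensor (G H : Graph) where

  T : Graph
  T = tensor G H

  V : Set
  V = Fin (n G * n H)

  π₁ : V → Fin (n G)
  π₁ = quotient {n G} (n H)

  π₂ : V → Fin (n H)
  π₂ = remainder {n G} (n H)

  ⟨_,_⟩ : Fin (n G) → Fin (n H) → V
  ⟨ x , y ⟩ = combine x y

  π₁-⟨,⟩ : ∀ x y → π₁ ⟨ x , y ⟩ ≡ x
  π₁-⟨,⟩ x y = cong proj₁ (remQuot-combine {n G} {n H} x y)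

  π₂-⟨,⟩ : ∀ x y → π₂ ⟨ x , y ⟩ ≡ y
  π₂-⟨,⟩ x y = cong proj₂ (remQuot-combine {n G} {n H} x y)

  ≡⟨,⟩ : ∀ {t x y} → π₁ t ≡ x → π₂ t ≡ y → t ≡ ⟨ x , y ⟩
  ≡⟨,⟩ {t} refl refl = sym (combine-remQuot {n G} (n H) t)

  Adj-⊗⁺ : ∀ {s t} → Adj G (π₁ s) (π₁ t) → Adj H (π₂ s) (π₂ t) → Adj T s t
  Adj-⊗⁺ g h rewrite g = h

  Adj-⊗⁻ : ∀ {s t} → Adj T s t → Adj G (π₁ s) (π₁ t) × Adj H (π₂ s) (π₂ t)
  Adj-⊗⁻ {s} {t} s~t with adj G (π₁ s) (π₁ t)
  ... | true = refl , s~t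

  Adj-⟨,⟩ : ∀ {v x y} → Adj G (π₁ v) x → Adj H (π₂ v) y → Adj T v ⟨ x , y ⟩
  Adj-⟨,⟩ {v} {x} {y} g h =
    Adj-⊗⁺ (subst (Adj G (π₁ v)) (sym (π₁-⟨,⟩ x y)) g) (subst (Adj H (π₂ v)) (sym (π₂-⟨,⟩ x y)) h)

  ⟨,⟩-Adj : ∀ {x y t} → Adj G x (π₁ t) → Adj H y (π₂ t) → Adj T ⟨ x , y ⟩ t
  ⟨,⟩-Adj g h = Adj-sym T (Adj-⟨,⟩ (Adj-sym G g) (Adj-sym H h))

  ⟨,⟩-Adj-⟨,⟩ : ∀ {x y x′ y′} → Adj G x x′ → Adj H y y′ → Adj T ⟨ x , y ⟩ ⟨ x′ , y′ ⟩
  ⟨,⟩-Adj-⟨,⟩ {x} {y} g h =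
    Adj-⟨,⟩ (subst (λ z → Adj G z _) (sym (π₁-⟨,⟩ x y)) g) (subst (λ z → Adj H z _) (sym (π₂-⟨,⟩ x y)) h)

  ⟨,⟩-Adj⁻ : ∀ {x y t} → Adj T ⟨ x , y ⟩ t → Adj G x (π₁ t) × Adj H y (π₂ t)
  ⟨,⟩-Adj⁻ {x} {y} xy~t with Adj-⊗⁻ xy~t
  ... | g , h = subst (λ z → Adj G z _) (π₁-⟨,⟩ x y) g , subst (λ z → Adj H z _) (π₂-⟨,⟩ x y) h

  π₁-⟨,⟩-≢ : ∀ {x c} y → x ≢ c → π₁ ⟨ x , y ⟩ ≢ c
  π₁-⟨,⟩-≢ {x} {c} y = subst (_≢ c) (sym (π₁-⟨,⟩ x y))

  π₂-⟨,⟩-≢ : ∀ {y c} x → y ≢ c → π₂ ⟨ x , y ⟩ ≢ c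
  π₂-⟨,⟩-≢ {y} {c} x = subst (_≢ c) (sym (π₂-⟨,⟩ x y))

  ⟨,⟩≢ₗ : ∀ {x y t} → x ≢ π₁ t → ⟨ x , y ⟩ ≢ t
  ⟨,⟩≢ₗ {x} {y} x≢t₁ refl = x≢t₁ (sym (π₁-⟨,⟩ x y))

  ⟨,⟩≢ᵣ : ∀ {x y t} → y ≢ π₂ t → ⟨ x , y ⟩ ≢ t
  ⟨,⟩≢ᵣ {x} {y} y≢t₂ refl = y≢t₂ (sym (π₂-⟨,⟩ x y))

  monitored-by-universal : ∀ {S a b t} → ⟨ a , b ⟩ ∈ S → Universal G a → Universal H b
                         → π₁ t ≢ a → π₂ t ≢ b → Monitored T S t
  monitored-by-universal ab∈S Ua Ub t₁≢a t₂≢b = nbr ab∈S (⟨,⟩-Adj (Ua _ t₁≢a) (Ub _ t₂≢b))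

module LowerBound (G H : Graph) (δG : MinDegree≥2 G) (δH : MinDegree≥2 H) where
  open Tensor G H

  Cross : Fin (n G) → Fin (n H) → V → Set
  Cross a b t = (π₁ t ≡ a × π₂ t ≢ b) ⊎ (π₁ t ≢ a × π₂ t ≡ b)

  ⟨a,y⟩∈Cross : ∀ {a b y} → y ≢ b → Cross a b ⟨ a , y ⟩
  ⟨a,y⟩∈Cross {a} {b} {y} y≢b = inj₁ (π₁-⟨,⟩ a y , π₂-⟨,⟩-≢ a y≢b)

  ⟨x,b⟩∈Cross : ∀ {a b x} → x ≢ a → Cross a b ⟨ x , b ⟩
  ⟨x,b⟩∈Cross {a} {b} {x} x≢a = inj₂ (π₁-⟨,⟩-≢ b x≢a , π₂-⟨,⟩ x b)

  ¬Cross-centre : ∀ {a b t} → π₁ t ≡ a × π₂ t ≡ b → ¬ Cross a b t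
  ¬Cross-centre (_    , t₂≡b) (inj₁ (_ , t₂≢b)) = t₂≢b t₂≡b
  ¬Cross-centre (t₁≡a , _)    (inj₂ (t₁≢a , _)) = t₁≢a t₁≡a

  ¬Cross-neighbour-of-centre : ∀ {a b u t} → Adj T u t → π₁ u ≡ a × π₂ u ≡ b → ¬ Cross a b t
  ¬Cross-neighbour-of-centre u~t (refl , _) (inj₁ (t₁≡u₁ , _)) =
    Adj⇒≢ G (proj₁ (Adj-⊗⁻ u~t)) (sym t₁≡u₁)
  ¬Cross-neighbour-of-centre u~t (_ , refl) (inj₂ (_ , t₂≡u₂)) =
    Adj⇒≢ H (proj₂ (Adj-⊗⁻ u~t)) (sym t₂≡u₂)

  -- For t in the row of a: if π₂ v ~ b, take t′ in the column of b; otherwise t′ stays in the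
  -- row of a, and its second coordinate, a neighbour of π₂ v, cannot be b. Columns are dual.
  Cross-second-neighbour : ∀ {a b v t} → Adj T v t → Cross a b t
                         → ∃[ t′ ] (Adj T v t′ × t′ ≢ t × Cross a b t′)
  Cross-second-neighbour {a} {b} {v} {t} v~t (inj₁ (refl , t₂≢b))
    with Adj-⊗⁻ v~t | Adj? H (π₂ v) b
  ... | _ , _ | yes v₂~b with neighbour-avoiding {G} δG (π₁ v) a
  ...   | x′ , v₁~x′ , x′≢a = ⟨ x′ , b ⟩ , Adj-⟨,⟩ v₁~x′ v₂~b , ⟨,⟩≢ᵣ (≢-sym t₂≢b) , ⟨x,b⟩∈Cross x′≢a
  Cross-second-neighbour {a} {b} {v} {t} v~t (inj₁ (refl , _)) | v₁~a , _ | no v₂≁b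
    with neighbour-avoiding {H} δH (π₂ v) (π₂ t)
  ...   | y′ , v₂~y′ , y′≢t₂ = ⟨ a , y′ ⟩ , Adj-⟨,⟩ v₁~a v₂~y′ , ⟨,⟩≢ᵣ y′≢t₂ ,
                               ⟨a,y⟩∈Cross (λ y′≡b → v₂≁b (subst (Adj H (π₂ v)) y′≡b v₂~y′))
  Cross-second-neighbour {a} {b} {v} {t} v~t (inj₂ (t₁≢a , refl))
    with Adj-⊗⁻ v~t | Adj? G (π₁ v) a
  ... | _ , _ | yes v₁~a with neighbour-avoiding {H} δH (π₂ v) b
  ...   | y′ , v₂~y′ , y′≢b = ⟨ a , y′ ⟩ , Adj-⟨,⟩ v₁~a v₂~y′ , ⟨,⟩≢ₗ (≢-sym t₁≢a) , ⟨a,y⟩∈Cross y′≢b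
  Cross-second-neighbour {a} {b} {v} {t} v~t (inj₂ (_ , refl)) | _ , v₂~b | no v₁≁a
    with neighbour-avoiding {G} δG (π₁ v) (π₁ t)
  ...   | x′ , v₁~x′ , x′≢t₁ = ⟨ x′ , b ⟩ , Adj-⟨,⟩ v₁~x′ v₂~b , ⟨,⟩≢ₗ x′≢t₁ ,
                               ⟨x,b⟩∈Cross (λ x′≡a → v₁≁a (subst (Adj G (π₁ v)) x′≡a v₁~x′))

  Cross-unmonitored : ∀ {X a b t} → (∀ {s} → s ∈ X → π₁ s ≡ a × π₂ s ≡ b)
                    → Monitored T X t → ¬ Cross a b t
  Cross-unmonitored centre (inS t∈X)     = ¬Cross-centre (centre t∈X)
  Cross-unmonitored centre (nbr u∈X u~t) = ¬Cross-neighbour-of-centre u~t (centre u∈X)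
  Cross-unmonitored centre (prop _ v~t others) t∈Cross
    with Cross-second-neighbour v~t t∈Cross
  ... | t′ , v~t′ , t′≢t , t′∈Cross = Cross-unmonitored centre (others t′ v~t′ t′≢t) t′∈Cross

  PowerDominating⇒2≤∣S∣ : ∀ {X} → V → PowerDominating T X → 2 ≤ ∣ X ∣
  PowerDominating⇒2≤∣S∣ {X} t₀ dom with 2 ≤? ∣ X ∣
  ... | yes 2≤∣X∣ = 2≤∣X∣
  ... | no 2≰∣X∣ with Monitored⇒Nonempty (dom t₀) | ≰⇒> 2≰∣X∣
  ...   | s , s∈X | s≤s ∣X∣≤1 with neighbour-avoiding {H} δH (π₂ s) (π₂ s)
  ...     | y , _ , y≢s₂ = ⊥-elim (Cross-unmonitored centre (dom ⟨ π₁ s , y ⟩) (⟨a,y⟩∈Cross y≢s₂))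
    where
    centre : ∀ {s′} → s′ ∈ X → π₁ s′ ≡ π₁ s × π₂ s′ ≡ π₂ s
    centre s′∈X with ∣p∣≤1⇒x∈p⇒y∈p⇒x≡y ∣X∣≤1 s′∈X s∈X
    ... | refl = refl , refl

module UpperBound (G H : Graph) {u₁ u₂ w : Fin (n G)} {v₁ v₂ : Fin (n H)}
  (U₁ : Universal G u₁) (U₂ : Universal G u₂) (u₁≢u₂ : u₁ ≢ u₂) (w≢u₁ : w ≢ u₁) (w≢u₂ : w ≢ u₂)
  (V₁ : Universal H v₁) (V₂ : Universal H v₂) (v₁≢v₂ : v₁ ≢ v₂) where
  open Tensor G H

  S : Subset (n G * n H)
  S = ⁅ ⟨ u₁ , v₁ ⟩ ⁆ ∪ ⁅ ⟨ u₂ , v₂ ⟩ ⁆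

  s₁∈S : ⟨ u₁ , v₁ ⟩ ∈ S
  s₁∈S = x∈p∪q⁺ (inj₁ (x∈⁅x⁆ _))

  s₂∈S : ⟨ u₂ , v₂ ⟩ ∈ S
  s₂∈S = x∈p∪q⁺ {p = ⁅ ⟨ u₁ , v₁ ⟩ ⁆} (inj₂ (x∈⁅x⁆ _))

  monitored-off-corners : ∀ t → t ≢ ⟨ u₁ , v₂ ⟩ → t ≢ ⟨ u₂ , v₁ ⟩ → Monitored T S t
  monitored-off-corners t t≢p t≢q with π₁ t ≟ u₁ | π₂ t ≟ v₁ | π₁ t ≟ u₂ | π₂ t ≟ v₂
  ... | no t₁≢u₁  | no t₂≢v₁  | _         | _         = monitored-by-universal s₁∈S U₁ V₁ t₁≢u₁ t₂≢v₁
  ... | _         | _         | no t₁≢u₂  | no t₂≢v₂  = monitored-by-universal s₂∈S U₂ V₂ t₁≢u₂ t₂≢v₂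
  ... | yes t₁≡u₁ | _         | yes t₁≡u₂ | _         = ⊥-elim (u₁≢u₂ (trans (sym t₁≡u₁) t₁≡u₂))
  ... | _         | yes t₂≡v₁ | _         | yes t₂≡v₂ = ⊥-elim (v₁≢v₂ (trans (sym t₂≡v₁) t₂≡v₂))
  ... | yes t₁≡u₁ | no _      | no _      | yes t₂≡v₂ = ⊥-elim (t≢p (≡⟨,⟩ t₁≡u₁ t₂≡v₂))
  ... | no _      | yes t₂≡v₁ | yes t₁≡u₂ | no _      = ⊥-elim (t≢q (≡⟨,⟩ t₁≡u₂ t₂≡v₁))

  monitored-u₁v₂ : Monitored T S ⟨ u₁ , v₂ ⟩
  monitored-u₁v₂ =
    prop (monitored-by-universal s₂∈S U₂ V₂ (π₁-⟨,⟩-≢ v₁ w≢u₂) (π₂-⟨,⟩-≢ w v₁≢v₂))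
         (⟨,⟩-Adj-⟨,⟩ (Adj-sym G (U₁ w w≢u₁)) (V₁ v₂ (≢-sym v₁≢v₂)))
         λ t wv₁~t t≢p → monitored-off-corners t t≢p
           (≢-sym (⟨,⟩≢ᵣ (Adj⇒≢ H (proj₂ (⟨,⟩-Adj⁻ wv₁~t)))))

  monitored-u₂v₁ : Monitored T S ⟨ u₂ , v₁ ⟩
  monitored-u₂v₁ =
    prop (monitored-by-universal s₁∈S U₁ V₁ (π₁-⟨,⟩-≢ v₂ w≢u₁) (π₂-⟨,⟩-≢ w (≢-sym v₁≢v₂)))
         (⟨,⟩-Adj-⟨,⟩ (Adj-sym G (U₂ w w≢u₂)) (V₂ v₁ v₁≢v₂))
         others
    where
    others : ∀ t → Adj T ⟨ w , v₂ ⟩ t → t ≢ ⟨ u₂ , v₁ ⟩ → Monitored T S t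
    others t _ t≢q with t ≟ ⟨ u₁ , v₂ ⟩
    ... | yes refl = monitored-u₁v₂
    ... | no t≢p   = monitored-off-corners t t≢p t≢q

  S-powerDominating : PowerDominating T S
  S-powerDominating t with t ≟ ⟨ u₁ , v₂ ⟩ | t ≟ ⟨ u₂ , v₁ ⟩
  ... | yes refl | _        = monitored-u₁v₂
  ... | no _     | yes refl = monitored-u₂v₁
  ... | no t≢p   | no t≢q   = monitored-off-corners t t≢p t≢q

  s₁~s₂ : Adj T ⟨ u₁ , v₁ ⟩ ⟨ u₂ , v₂ ⟩
  s₁~s₂ = ⟨,⟩-Adj-⟨,⟩ (U₁ u₂ (≢-sym u₁≢u₂)) (V₁ v₂ (≢-sym v₁≢v₂))

  S-connected : InducedConnected T S
  S-connected s t s∈S t∈S with x∈⁅y⁆∪⁅z⁆⁻ s∈S | x∈⁅y⁆∪⁅z⁆⁻ t∈S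
  ... | inj₁ refl | inj₁ refl = here
  ... | inj₂ refl | inj₂ refl = here
  ... | inj₁ refl | inj₂ refl = step here s₁~s₂ s₂∈S
  ... | inj₂ refl | inj₁ refl = step here (Adj-sym T s₁~s₂) s₁∈S

  ∣S∣≡2 : ∣ S ∣ ≡ 2
  ∣S∣≡2 = ∣⁅x⁆∪⁅y⁆∣≡2 (⟨,⟩≢ₗ (≢-sym (π₁-⟨,⟩-≢ v₂ (≢-sym u₁≢u₂))))

theorem12 : (G H : Graph)
    → Connected G → ¬ Bipartite G → AtLeastTwoUniversal G
    → Connected H → ¬ Bipartite H → AtLeastTwoUniversal H
    → ConnPowerDomNumber (tensor G H) 2
theorem12 G H _ ¬bipG (u₁ , u₂ , u₁≢u₂ , U₁ , U₂) _ ¬bipH (v₁ , v₂ , v₁≢v₂ , V₁ , V₂)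
  with ¬Bipartite⇒third-vertex G ¬bipG u₁ u₂ | ¬Bipartite⇒third-vertex H ¬bipH v₁ v₂
... | w , w≢u₁ , w≢u₂ | z , z≢v₁ , z≢v₂ =
  (S , (S-powerDominating , S-connected) , ∣S∣≡2) ,
  λ X (X-dominating , _) → PowerDominating⇒2≤∣S∣ ⟨ u₁ , v₁ ⟩ X-dominating
  where
  open Tensor G H using (⟨_,_⟩)
  open UpperBound G H U₁ U₂ u₁≢u₂ w≢u₁ w≢u₂ V₁ V₂ v₁≢v₂
  open LowerBound G H (twoUniversal⇒MinDegree≥2 {G} U₁ U₂ u₁≢u₂ w≢u₁ w≢u₂)
                      (twoUniversal⇒MinDegree≥2 {H} V₁ V₂ v₁≢v₂ z≢v₁ z≢v₂)
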